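{- Let $3\le m\le n$ and let $c$ be an exact $(m+n+1)$-coloring of $[m]\times[n]$ with no rainbow solution to $x_1+x_2=x_3$ and with $|c(D_m)|=3$. Then each off-diagonal $D_k$ contributes exactly one color $c_k$, and $c_k\notin c\big(([m]\times[n])\setminus D_k\big)$.
   Context: $[m]\times[n]=\{(i,j)\in\mathbb{Z}^2:1\le i\le m,1\le j\le n\}$ with componentwise addition. An $r$-coloring is a map $c:[m]\times[n]\to\{1,\dots,r\}$, exact if surjective; a rainbow solution is a triple $\alpha,\beta,\gamma$ with $\alpha+\beta=\gamma$ and pairwise distinct colors. For $1\le k\le m+n-1$, $D_k=\{(i,j)\in[m]\times[n]:m-k=i-j\}$; $D_m$ is the main diagonal and $D_k$, $k\ne m$, are off-diagonals; $c(X)=\{c(x):x\in X\}$. Diagonal $D_j$ contributes color $x$ if $x\in c(D_j)\setminus c(D_m)$ and $x\notin c(D_i)$ for all $i<j$. -}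

module Defs where

open import Data.Nat using (ℕ; _+_; _≤_; _<_)
open import Data.Product using (_×_; _,_; ∃; Σ-syntax; ∃-syntax)
open import Relation.Binary.PropositionalEquality using (_≡_; _≢_)
open import Relation.Nullary using (¬_)
open import Data.Sum using (_⊎_)

-- A point of ℤ² with positive coordinates, written as a pair of naturals.
Point : Set
Point = ℕ × ℕ

InGrid : ℕ → ℕ → Point → Set
InGrid m n (i , j) = (1 ≤ i × i ≤ m) × (1 ≤ j × j ≤ n)

_⊕_ : Point → Point → Point
(a , b) ⊕ (c , d) = (a + c , b + d)

-- A coloring of [m]×[n]; only its values on the grid matter.
Coloring : Set
Coloring = Point → ℕ

ExactColoring : ℕ → ℕ → ℕ → Coloring → Set
ExactColoring m n r c =
  (∀ p → InGrid m n p → 1 ≤ c p × c p ≤ r) ×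
  (∀ x → 1 ≤ x → x ≤ r → ∃[ p ] (InGrid m n p × c p ≡ x))

PairwiseDistinct : ℕ → ℕ → ℕ → Set
PairwiseDistinct x y z = x ≢ y × x ≢ z × y ≢ z

NoRainbow : ℕ → ℕ → Coloring → Set
NoRainbow m n c = ∀ α β γ → InGrid m n α → InGrid m n β → InGrid m n γ →
  α ⊕ β ≡ γ → ¬ PairwiseDistinct (c α) (c β) (c γ)

-- (i , j) ∈ D_k  iff  (i,j) ∈ [m]×[n] and m - k = i - j (in ℤ), i.e. m + j = i + k
InDiag : ℕ → ℕ → ℕ → Point → Set
InDiag m n k (i , j) = InGrid m n (i , j) × m + j ≡ i + k

ColorOn : ℕ → ℕ → Coloring → ℕ → ℕ → Set
ColorOn m n c k x = ∃[ p ] (InDiag m n k p × c p ≡ x)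

MainDiagThreeColors : ℕ → ℕ → Coloring → Set
MainDiagThreeColors m n c =
  Σ[ a ∈ ℕ ] Σ[ b ∈ ℕ ] Σ[ d ∈ ℕ ]
    (PairwiseDistinct a b d ×
     ColorOn m n c m a × ColorOn m n c m b × ColorOn m n c m d ×
     (∀ x → ColorOn m n c m x → (x ≡ a ⊎ x ≡ b ⊎ x ≡ d)))

Contributes : ℕ → ℕ → Coloring → ℕ → ℕ → Set
Contributes m n c j x =
  ColorOn m n c j x × ¬ ColorOn m n c m x ×
  (∀ i → 1 ≤ i → i < j → ¬ ColorOn m n c i x)

{-# OPTIONS --safe #-}
-- On a diagonal D_k two points p and q = p + (t , t) with colours missing from c(D_m) must have
-- equal colours, since (t , t) ∈ D_m and p + (t , t) = q is otherwise rainbow. Hence sending the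
-- three main-diagonal colours to 0, m, m + n and every other colour to a diagonal it occurs on
-- injects the m + n + 1 colours into {0, …, m + n}. The injection is onto, so each off-diagonal
-- carries exactly one off-main colour, and that colour occurs on no other diagonal.
module Submission where

open import Defs
open import Data.Nat using (ℕ; suc; _+_; _∸_; _≤_; _<_; z≤n; s≤s; >-nonZero)
open import Data.Nat.Properties
open import Data.Fin as Fin using (Fin; toℕ; fromℕ<; punchOut)
open import Data.Fin.Properties
  using (any?; injective⇒≤; punchOut-injective; toℕ-fromℕ<; toℕ-injective; toℕ<n)
open import Data.Product using (_×_; _,_; proj₁; proj₂; ∃-syntax)
open import Data.Sum using (_⊎_; [_,_]′)
open import Function using (_∘_)
open import Function.Definitions using (Injective)
open import Relation.Binary.Definitions using (tri<; tri≈; tri>)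
open import Relation.Binary.PropositionalEquality
  using (_≡_; _≢_; refl; sym; trans; cong; cong₂; subst; module ≡-Reasoning)
open import Relation.Nullary using (¬_; yes; no; contradiction)
open import Relation.Nullary.Decidable using (decidable-stable)

injective⇒surjective : ∀ {N} {f : Fin N → Fin N} → Injective _≡_ _≡_ f →
                       ∀ y → ∃[ x ] f x ≡ y
injective⇒surjective {suc N} {f} f-injective y with any? (λ x → f x Fin.≟ y)
... | yes hit = hit
... | no miss = contradiction (injective⇒≤ g-injective) 1+n≰n
  where
  g : Fin (suc N) → Fin N
  g x = punchOut (λ y≡fx → miss (x , sym y≡fx))

  g-injective : Injective _≡_ _≡_ g
  g-injective eq = f-injective (punchOut-injective {i = y} _ _ eq)

OffMain : ℕ → ℕ → Coloring → ℕ → Set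
OffMain m n c x = ¬ ColorOn m n c m x

OffDiagonal : ℕ → ℕ → ℕ → Set
OffDiagonal m n k = 1 ≤ k × k < m + n × k ≢ m

-- The truncated subtraction is exact on the grid, where i ≤ m.
diag : ℕ → Point → ℕ
diag m (i , j) = m + j ∸ i

module _ {m n : ℕ} where

  diag+row : ∀ {i j} → InGrid m n (i , j) → diag m (i , j) + i ≡ m + j
  diag+row {i} {j} ((_ , i≤m) , _) = m∸n+n≡m (≤-trans i≤m (m≤m+n m j))

  InDiag-diag : ∀ {p} → InGrid m n p → InDiag m n (diag m p) p
  InDiag-diag {i , j} p∈ = p∈ , trans (sym (diag+row p∈)) (+-comm _ i)

  InDiag⇒≡diag : ∀ {k i j} → InDiag m n k (i , j) → k ≡ diag m (i , j)
  InDiag⇒≡diag {k} {i} (_ , eq) = sym (trans (cong (_∸ i) eq) (m+n∸m≡n i k))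

  diag-positive : ∀ {p} → InGrid m n p → 1 ≤ diag m p
  diag-positive {i , j} ((_ , i≤m) , (1≤j , _)) = begin
    1              ≤⟨ 1≤j ⟩
    j              ≡⟨ m+n∸m≡n i j ⟨
    i + j ∸ i      ≤⟨ ∸-monoˡ-≤ i (+-monoˡ-≤ j i≤m) ⟩
    diag m (i , j) ∎
    where open ≤-Reasoning

  diag<m+n : ∀ {p} → InGrid m n p → diag m p < m + n
  diag<m+n {i , j} p∈@((1≤i , _) , (_ , j≤n)) = begin-strict
    diag m (i , j)     <⟨ m<m+n _ 1≤i ⟩
    diag m (i , j) + i ≡⟨ diag+row p∈ ⟩
    m + j              ≤⟨ +-monoʳ-≤ m j≤n ⟩
    m + n              ∎
    where open ≤-Reasoning

  InDiag-sameRow : ∀ {k i j j′} → InDiag m n k (i , j) → InDiag m n k (i , j′) → j ≡ j′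
  InDiag-sameRow (_ , eq) (_ , eq′) = +-cancelˡ-≡ m _ _ (trans eq (sym eq′))

  InDiag-difference : ∀ {k i j i′ j′} → InDiag m n k (i , j) → InDiag m n k (i′ , j′) →
                      i < i′ → ∃[ t ] (InDiag m n m (t , t) × (i , j) ⊕ (t , t) ≡ (i′ , j′))
  InDiag-difference {k} {i} {j} {i′} {j′} (_ , eq) (((_ , i′≤m) , (_ , j′≤n)) , eq′) i<i′ =
    t , (((1≤t , ≤-trans (m∸n≤m i′ i) i′≤m) , (1≤t , ≤-trans t≤j′ j′≤n)) , +-comm m t) ,
    cong₂ _,_ (sym i′≡i+t) (sym j′≡j+t)
    where
    t = i′ ∸ i
    1≤t = m<n⇒0<n∸m i<i′
    i′≡i+t : i′ ≡ i + t
    i′≡i+t = sym (m+[n∸m]≡n (<⇒≤ i<i′))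
    j′≡j+t : j′ ≡ j + t
    j′≡j+t = +-cancelˡ-≡ m _ _ (begin
      m + j′      ≡⟨ eq′ ⟩
      i′ + k      ≡⟨ cong (_+ k) i′≡i+t ⟩
      i + t + k   ≡⟨ +-assoc i t k ⟩
      i + (t + k) ≡⟨ cong (i +_) (+-comm t k) ⟩
      i + (k + t) ≡⟨ +-assoc i k t ⟨
      i + k + t   ≡⟨ cong (_+ t) eq ⟨
      m + j + t   ≡⟨ +-assoc m j t ⟩
      m + (j + t) ∎)
      where open ≡-Reasoning
    t≤j′ : t ≤ j′
    t≤j′ = subst (t ≤_) (sym j′≡j+t) (m≤n+m t j)

module _ {m n : ℕ} {c : Coloring} where

  OffMain-diag : ∀ {x p} → OffMain m n c x → InGrid m n p → c p ≡ x →
                 OffDiagonal m n (diag m p)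
  OffMain-diag {p = p} x-off p∈ cp≡x =
    diag-positive p∈ , diag<m+n p∈ ,
    λ diag≡m → x-off (p , subst (λ k → InDiag m n k p) diag≡m (InDiag-diag p∈) , cp≡x)

  ColorOn-OffDiagonal : ∀ {k x} → OffMain m n c x → ColorOn m n c k x → OffDiagonal m n k
  ColorOn-OffDiagonal x-off (p , p∈k , cp≡x) =
    subst (OffDiagonal m n) (sym (InDiag⇒≡diag p∈k)) (OffMain-diag x-off (proj₁ p∈k) cp≡x)

  OffMain≢onMain : ∀ {x r} → OffMain m n c x → InDiag m n m r → x ≢ c r
  OffMain≢onMain x-off r∈ x≡cr = x-off (_ , r∈ , sym x≡cr)

  OffMain-onDiagonal-¬≢ : NoRainbow m n c →
    ∀ {k i j i′ j′} → InDiag m n k (i , j) → InDiag m n k (i′ , j′) → i < i′ →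
    OffMain m n c (c (i , j)) → OffMain m n c (c (i′ , j′)) → ¬ c (i , j) ≢ c (i′ , j′)
  OffMain-onDiagonal-¬≢ noRainbow p∈ q∈ i<i′ p-off q-off cp≢cq
    with t , t∈ , p+t≡q ← InDiag-difference p∈ q∈ i<i′ =
    noRainbow _ _ _ (proj₁ p∈) (proj₁ t∈) (proj₁ q∈) p+t≡q
      (OffMain≢onMain p-off t∈ , cp≢cq , OffMain≢onMain q-off t∈ ∘ sym)

  OffMain-unique : NoRainbow m n c → ∀ {k x y} → OffMain m n c x → OffMain m n c y →
                   ColorOn m n c k x → ColorOn m n c k y → x ≡ y
  OffMain-unique noRainbow x-off y-off ((i , j) , p∈ , refl) ((i′ , j′) , q∈ , refl)
    with <-cmp i i′
  ... | tri< i<i′ _ _ = decidable-stable (_ ≟ _)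
    (OffMain-onDiagonal-¬≢ noRainbow p∈ q∈ i<i′ x-off y-off)
  ... | tri> _ _ i′<i = sym (decidable-stable (_ ≟ _)
    (OffMain-onDiagonal-¬≢ noRainbow q∈ p∈ i′<i y-off x-off))
  ... | tri≈ _ refl _ = cong (λ j → c (i , j)) (InDiag-sameRow p∈ q∈)

-- Only c(D_m) ⊆ {a , b , d} is used; a, b, d need not be distinct.
module Counting {m n : ℕ} {c : Coloring} (0<m : 0 < m) (0<n : 0 < n)
  (exact : ExactColoring m n (m + n + 1) c) (noRainbow : NoRainbow m n c)
  (a b d : ℕ) (main⊆ : ∀ x → ColorOn m n c m x → x ≡ a ⊎ x ≡ b ⊎ x ≡ d) where

  data Kind (x : ℕ) : Set where
    is-a : x ≡ a → Kind x
    is-b : x ≡ b → Kind x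
    is-d : x ≡ d → Kind x
    off-main : OffMain m n c x → ∀ {p} → InGrid m n p → c p ≡ x → Kind x

  kind : ∀ x → 1 ≤ x → x ≤ m + n + 1 → Kind x
  kind x 1≤x x≤R with x ≟ a | x ≟ b | x ≟ d
  ... | yes x≡a | _       | _       = is-a x≡a
  ... | no _    | yes x≡b | _       = is-b x≡b
  ... | no _    | no _    | yes x≡d = is-d x≡d
  ... | no x≢a  | no x≢b  | no x≢d
    with p , p∈ , cp≡x ← proj₂ exact x 1≤x x≤R =
    off-main (λ x∈main → [ x≢a , [ x≢b , x≢d ]′ ]′ (main⊆ x x∈main)) p∈ cp≡x

  slot : ∀ {x} → Kind x → ℕ
  slot (is-a _)             = m
  slot (is-b _)             = 0
  slot (is-d _)             = m + n
  slot (off-main _ {p} _ _) = diag m p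

  m<m+n′ : m < m + n
  m<m+n′ = m<m+n m 0<n

  m+n<R : m + n < m + n + 1
  m+n<R = m<m+n (m + n) (s≤s z≤n)

  slot<R : ∀ {x} (κ : Kind x) → slot κ < m + n + 1
  slot<R (is-a _)          = <-trans m<m+n′ m+n<R
  slot<R (is-b _)          = ≤-<-trans z≤n m+n<R
  slot<R (is-d _)          = m+n<R
  slot<R (off-main _ p∈ _) = <-trans (diag<m+n p∈) m+n<R

  ColorOn-slot : ∀ {x} (κ : Kind x) → OffDiagonal m n (slot κ) →
                 OffMain m n c x × ColorOn m n c (slot κ) x
  ColorOn-slot (is-a _)                 (_ , _ , m≢m)     = contradiction refl m≢m
  ColorOn-slot (is-b _)                 (() , _)
  ColorOn-slot (is-d _)                 (_ , m+n<m+n , _) = contradiction m+n<m+n (<-irrefl refl)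
  ColorOn-slot (off-main x-off p∈ cp≡x) _                 = x-off , _ , InDiag-diag p∈ , cp≡x

  offDiagonal-slot-injective : ∀ {x y} (κ : Kind x) (κ′ : Kind y) → slot κ ≡ slot κ′ →
                               OffDiagonal m n (slot κ) → x ≡ y
  offDiagonal-slot-injective κ κ′ eq κ-off
    with x-off , x∈ ← ColorOn-slot κ κ-off
       | y-off , y∈ ← ColorOn-slot κ′ (subst (OffDiagonal m n) eq κ-off) =
    OffMain-unique noRainbow x-off y-off x∈ (subst (λ k → ColorOn m n c k _) (sym eq) y∈)

  slot-injective : ∀ {x y} (κ : Kind x) (κ′ : Kind y) → slot κ ≡ slot κ′ → x ≡ y
  slot-injective (is-a x≡a) (is-a y≡a) _ = trans x≡a (sym y≡a)
  slot-injective (is-b x≡b) (is-b y≡b) _ = trans x≡b (sym y≡b)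
  slot-injective (is-d x≡d) (is-d y≡d) _ = trans x≡d (sym y≡d)
  slot-injective κ@(off-main x-off p∈ cp≡x) κ′ eq =
    offDiagonal-slot-injective κ κ′ eq (OffMain-diag x-off p∈ cp≡x)
  slot-injective κ κ′@(off-main y-off q∈ cq≡y) eq =
    sym (offDiagonal-slot-injective κ′ κ (sym eq) (OffMain-diag y-off q∈ cq≡y))
  slot-injective (is-a _) (is-b _) eq = contradiction (sym eq) (<⇒≢ 0<m)
  slot-injective (is-b _) (is-a _) eq = contradiction eq (<⇒≢ 0<m)
  slot-injective (is-a _) (is-d _) eq = contradiction eq (<⇒≢ m<m+n′)
  slot-injective (is-d _) (is-a _) eq = contradiction (sym eq) (<⇒≢ m<m+n′)
  slot-injective (is-b _) (is-d _) eq = contradiction eq (<⇒≢ (<-trans 0<m m<m+n′))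
  slot-injective (is-d _) (is-b _) eq = contradiction (sym eq) (<⇒≢ (<-trans 0<m m<m+n′))

  colour : Fin (m + n + 1) → ℕ
  colour i = suc (toℕ i)

  colour-injective : Injective _≡_ _≡_ colour
  colour-injective = toℕ-injective ∘ suc-injective

  kindᶠ : (i : Fin (m + n + 1)) → Kind (colour i)
  kindᶠ i = kind (colour i) (s≤s z≤n) (toℕ<n i)

  slotᶠ : Fin (m + n + 1) → Fin (m + n + 1)
  slotᶠ i = fromℕ< (slot<R (kindᶠ i))

  slotᶠ-injective : Injective _≡_ _≡_ slotᶠ
  slotᶠ-injective {i} {j} eq = colour-injective (slot-injective (kindᶠ i) (kindᶠ j) (begin
    slot (kindᶠ i) ≡⟨ toℕ-fromℕ< _ ⟨
    toℕ (slotᶠ i)  ≡⟨ cong toℕ eq ⟩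
    toℕ (slotᶠ j)  ≡⟨ toℕ-fromℕ< _ ⟩
    slot (kindᶠ j) ∎))
    where open ≡-Reasoning

  OffDiagonal-slot : ∀ {k} → OffDiagonal m n k → ∃[ i ] slot (kindᶠ i) ≡ k
  OffDiagonal-slot {k} (_ , k<m+n , _)
    with i , slotᶠi≡k ← injective⇒surjective slotᶠ-injective (fromℕ< (<-trans k<m+n m+n<R)) =
    i , (begin
      slot (kindᶠ i)                     ≡⟨ toℕ-fromℕ< _ ⟨
      toℕ (slotᶠ i)                      ≡⟨ cong toℕ slotᶠi≡k ⟩
      toℕ (fromℕ< (<-trans k<m+n m+n<R)) ≡⟨ toℕ-fromℕ< _ ⟩
      k                                  ∎)
    where open ≡-Reasoning

  OffDiagonal-slot-colour : ∀ {k i} → OffDiagonal m n k → slot (kindᶠ i) ≡ k →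
                            OffMain m n c (colour i) × ColorOn m n c k (colour i)
  OffDiagonal-slot-colour {k} {i} k-off slot≡k =
    subst (λ l → OffMain m n c (colour i) × ColorOn m n c l (colour i)) slot≡k
      (ColorOn-slot (kindᶠ i) (subst (OffDiagonal m n) (sym slot≡k) k-off))

  OffDiagonal-colour : ∀ {k} → OffDiagonal m n k → ∃[ x ] (OffMain m n c x × ColorOn m n c k x)
  OffDiagonal-colour k-off with i , slot≡k ← OffDiagonal-slot k-off =
    colour i , OffDiagonal-slot-colour k-off slot≡k

  OffMain≡slot-colour : ∀ {x k i} → OffMain m n c x → ColorOn m n c k x →
                        slot (kindᶠ i) ≡ k → x ≡ colour i
  OffMain≡slot-colour x-off x∈k slot≡k
    with i-off , i∈k ← OffDiagonal-slot-colour (ColorOn-OffDiagonal x-off x∈k) slot≡k =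
    OffMain-unique noRainbow x-off i-off x∈k i∈k

  OffMain-single-diagonal : ∀ {x k l} → OffMain m n c x →
                            ColorOn m n c k x → ColorOn m n c l x → k ≡ l
  OffMain-single-diagonal {k = k} {l} x-off x∈k x∈l
    with i , slot-i≡k ← OffDiagonal-slot (ColorOn-OffDiagonal x-off x∈k)
       | j , slot-j≡l ← OffDiagonal-slot (ColorOn-OffDiagonal x-off x∈l) = begin
      k              ≡⟨ slot-i≡k ⟨
      slot (kindᶠ i) ≡⟨ cong (λ i → slot (kindᶠ i)) (colour-injective colourᵢ≡colourⱼ) ⟩
      slot (kindᶠ j) ≡⟨ slot-j≡l ⟩
      l              ∎
    where
    open ≡-Reasoning
    colourᵢ≡colourⱼ = trans (sym (OffMain≡slot-colour x-off x∈k slot-i≡k))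
                            (OffMain≡slot-colour x-off x∈l slot-j≡l)

lemma3p1 : (m n : ℕ) → 3 ≤ m → m ≤ n → (c : Coloring) →
    ExactColoring m n (m + n + 1) c → NoRainbow m n c →
    MainDiagThreeColors m n c →
    ∀ k → 1 ≤ k → k ≤ m + n ∸ 1 → k ≢ m →
      ∃[ ck ] (Contributes m n c k ck ×
               (∀ x → Contributes m n c k x → x ≡ ck) ×
               (∀ p → InGrid m n p → ¬ InDiag m n k p → c p ≢ ck))
lemma3p1 m n 3≤m m≤n c exact noRainbow (a , b , d , _ , _ , _ , _ , main⊆) k 1≤k k≤m+n∸1 k≢m =
  let x , x-off , x∈k = OffDiagonal-colour (1≤k , k<m+n , k≢m) in
  x ,
  (x∈k , x-off , λ l _ l<k x∈l → <⇒≢ l<k (OffMain-single-diagonal x-off x∈l x∈k)) ,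
  (λ y (y∈k , y-off , _) → OffMain-unique noRainbow y-off x-off y∈k x∈k) ,
  λ p p∈ p∉k cp≡x → p∉k (subst (λ l → InDiag m n l p)
    (OffMain-single-diagonal x-off (p , InDiag-diag p∈ , cp≡x) x∈k) (InDiag-diag p∈))
  where
  0<m : 0 < m
  0<m = ≤-trans (s≤s z≤n) 3≤m
  open Counting 0<m (≤-trans 0<m m≤n) exact noRainbow a b d main⊆
  k<m+n : k < m + n
  k<m+n = m≤pred[n]⇒suc[m]≤n {{>-nonZero (≤-trans 0<m (m≤m+n m n))}} k≤m+n∸1
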